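{- Let $G$ be a $(C_4,H)$-dumbbell. If $H$ admits a $(2k+1,k)$-configuration for some integer $k\ge 3$, then $G$ admits a $(2k+1,k)$-configuration.
   Context: A path in $G$ is binary if all its internal vertices have degree $2$ in $G$. For graphs $H_1,H_2$ with at most one common vertex, $G$ is an $(H_1,H_2)$-dumbbell if $G$ is the union of $H_1$, $H_2$ and a path $P$ such that: (1) $P$ is a binary path in $G$ with $|V(P)|\ge1$; (2) for each $i$, $V(H_i)\cap V(P)$ is a single vertex, an end-vertex of $P$; (3) if $|V(P)|\ge 2$ then $H_1,H_2$ are vertex disjoint. Here $C_4$ is the $4$-cycle. A set is dominating if every vertex outside it has a neighbour in it; a $(k,s)$-configuration is a multiset of $k$ dominating sets such that every vertex lies in at most $s$ of them. -}

module Defs where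

open import Level using (0ℓ)
open import Data.Nat using (ℕ; zero; suc; _+_; _≤_; _<_)
open import Data.Fin using (Fin; toℕ; inject₁; fromℕ)
import Data.Fin as F
open import Data.Fin.Subset using (Subset; _∈_; _∉_)
open import Data.Vec using (Vec; []; _∷_; lookup)
open import Data.Bool using (true; false)
open import Data.Product using (_×_; ∃; ∃-syntax; Σ-syntax)
open import Data.Sum using (_⊎_)
open import Data.Empty using (⊥)
open import Relation.Nullary using (¬_)
open import Relation.Binary.PropositionalEquality using (_≡_; _≢_)
open import Function.Bundles using (_⇔_)

-- A (finite, simple) graph whose vertices form a subset V of Fin n
-- (so that graphs and their subgraphs live in the same ambient vertex type).
record Graph (n : ℕ) : Set₁ where
  field
    V       : Fin n → Set
    E       : Fin n → Fin n → Set
    E-sym   : ∀ {x y} → E x y → E y x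
    E-irr   : ∀ {x} → ¬ E x x
    E-V     : ∀ {x y} → E x y → V x
open Graph public

edgeOf : ∀ {n} → Fin n → Fin n → Fin n → Fin n → Set
edgeOf u v x y = (x ≡ u × y ≡ v) ⊎ (x ≡ v × y ≡ u)

Degree2 : ∀ {n} → Graph n → Fin n → Set
Degree2 G v = Σ[ a ∈ _ ] Σ[ b ∈ _ ]
  (a ≢ b × E G v a × E G v b × (∀ w → E G v w → w ≡ a ⊎ w ≡ b))

IsC4 : ∀ {n} → Graph n → Set
IsC4 {n} H = Σ[ a ∈ Fin n ] Σ[ b ∈ Fin n ] Σ[ c ∈ Fin n ] Σ[ d ∈ Fin n ]
  ( a ≢ b × a ≢ c × a ≢ d × b ≢ c × b ≢ d × c ≢ d
  × (∀ x → V H x ⇔ (x ≡ a ⊎ x ≡ b ⊎ x ≡ c ⊎ x ≡ d))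
  × (∀ x y → E H x y ⇔
       (edgeOf a b x y ⊎ edgeOf b c x y ⊎ edgeOf c d x y ⊎ edgeOf d a x y)))

-- G is an (H₁,H₂)-dumbbell: union of H₁, H₂ and a path P = p 0, …, p l
-- (|V(P)| = l+1 ≥ 1). Orientation: H₁ meets P at p 0, H₂ at p l (WLOG).
IsDumbbell : ∀ {n} → Graph n → Graph n → Graph n → Set
IsDumbbell {n} G H₁ H₂ =
  (∀ x y → V H₁ x → V H₂ x → V H₁ y → V H₂ y → x ≡ y) ×
  Σ[ l ∈ ℕ ] Σ[ p ∈ (Fin (suc l) → Fin n) ]
    (
      (∀ i j → p i ≡ p j → i ≡ j)
    × (∀ (i : Fin l) → E G (p (inject₁ i)) (p (F.suc i)))
    × (∀ (i : Fin (suc l)) → 0 < toℕ i → toℕ i < l → Degree2 G (p i))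
    × (∀ i → V H₁ (p i) ⇔ (i ≡ F.zero))
    × (∀ i → V H₂ (p i) ⇔ (i ≡ fromℕ l))
    × (1 ≤ l → ∀ x → V H₁ x → V H₂ x → ⊥)
    × (∀ x → V G x ⇔ (V H₁ x ⊎ V H₂ x ⊎ ∃[ i ] x ≡ p i))
    × (∀ x y → E G x y ⇔
         (E H₁ x y ⊎ E H₂ x y ⊎ ∃[ i ] edgeOf (p (inject₁ i)) (p (F.suc i)) x y)))

Dominating : ∀ {n} → Graph n → Subset n → Set
Dominating H D =
  (∀ x → x ∈ D → V H x) ×
  (∀ x → V H x → x ∉ D → ∃[ y ] (y ∈ D × E H x y))

count : ∀ {n m} → Vec (Subset n) m → Fin n → ℕ
count []       x = 0
count (D ∷ Ds) x with lookup D x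
... | true  = suc (count Ds x)
... | false = count Ds x

-- a (k,s)-configuration of H: k dominating sets (a multiset, given as a
-- vector), every vertex in at most s of them
Configuration : ∀ {n} → Graph n → ℕ → ℕ → Set
Configuration {n} H k s = Σ[ Ds ∈ Vec (Subset n) k ]
  ((∀ j → Dominating H (lookup Ds j)) × (∀ x → V H x → count Ds x ≤ s))

module Submission where

-- Write k = 3 + m, let the 4-cycle a b c d meet the path p 0 = a, …, p l at a, and let pₗ = p l ∈ H.
-- Label the 2k + 1 dominating sets of H by slots, k of kind a and k + 1 of kind b, so that every set
-- containing pₗ gets kind a; this is possible because pₗ lies in at most k of them. Add each vertex of
-- the path and of the cycle to the sets of the slots prescribed by a finite table, according to its
-- position on the path modulo 3 and, on the cycle, to the phase of a. The tables are chosen so that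
-- every such vertex joins at most k sets, pₗ joins exactly the sets of kind a (keeping its load at k),
-- and the closed neighbourhood of every vertex outside H meets every slot.

open import Defs
open import Data.Bool using (Bool; true; false; T; not; _∧_; _∨_; if_then_else_)
open import Data.Bool.ListAction using (any)
open import Data.Bool.Properties using (T-∧; T-∨; ∨-identityʳ)
open import Data.Empty using (⊥; ⊥-elim)
open import Data.Fin as Fin using (Fin; toℕ; inject₁; fromℕ; lower₁)
open import Data.Fin.Properties using (any?; toℕ-fromℕ; toℕ-injective; inject₁-lower₁)
open import Data.Fin.Subset using (Subset; _∈_; _∪_)
open import Data.Fin.Subset.Properties using (x∈p∪q⁻; p⊆p∪q; q⊆p∪q)
open import Data.List using (List; []; _∷_; _++_; length; map; replicate; zip; filter)
open import Data.List.Properties using (length-++; length-map; length-replicate)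
open import Data.List.Relation.Binary.Permutation.Propositional using (_↭_; prep; ↭-reflexive; ↭-sym; ↭-trans)
open import Data.List.Relation.Binary.Permutation.Propositional.Properties
  using (filter-↭; ↭-length; shift; All-resp-↭)
open import Data.List.Relation.Unary.All as All using (All; []; _∷_)
open import Data.List.Relation.Unary.All.Properties using (all-filter; map⁺; map⁻; replicate⁺)
open import Data.Maybe using (Maybe; just; nothing; maybe′)
open import Data.Maybe.Properties using (just-injective)
open import Data.Nat as ℕ using (ℕ; zero; suc; _+_; _*_; _≤_; _≤ᵇ_; z≤n; s≤s)
open import Data.Nat.Properties
  using (module ≤-Reasoning; n≢0⇒n>0; ≤-refl; ≤-reflexive; +-mono-≤; +-identityʳ; ≤ᵇ⇒≤)
open import Data.Nat.GeneralisedArithmetic using (fold)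
open import Data.Nat.Tactic.RingSolver using (solve-∀)
open import Data.Product using (Σ-syntax; ∃-syntax; _×_; _,_; proj₁; proj₂)
open import Data.Sum using (_⊎_; inj₁; inj₂; [_,_]′; map₂)
open import Data.Vec as Vec using (Vec; lookup; tabulate; toList; fromList)
open import Data.Vec.Properties using (lookup-zipWith; lookup∘tabulate; []=⇒lookup; lookup⇒[]=; length-toList)
open import Function using (_∘_)
open import Function.Bundles using (_⇔_; mk⇔; Equivalence)
open import Relation.Nullary using (¬_; yes; no)
open import Relation.Nullary.Decidable using (T?)
open import Relation.Unary using (Decidable)
open import Relation.Unary.Properties using (∁?)
open import Relation.Binary.PropositionalEquality
open Equivalence using (to; from)

tally : {A : Set} → (A → Bool) → List A → ℕ
tally f = length ∘ filter (T? ∘ f)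

module _ {A : Set} (f : A → Bool) where

  tally-++ : ∀ xs ys → tally f (xs ++ ys) ≡ tally f xs + tally f ys
  tally-++ []       ys = refl
  tally-++ (x ∷ xs) ys with f x
  ... | true  = cong suc (tally-++ xs ys)
  ... | false = tally-++ xs ys

  tally-replicate : ∀ m x → tally f (replicate m x) ≡ (if f x then m else 0)
  tally-replicate zero    x with f x
  ... | true  = refl
  ... | false = refl
  tally-replicate (suc m) x with f x | tally-replicate m x
  ... | true  | ih = cong suc ih
  ... | false | ih = ih

  tally-map : ∀ {B : Set} (g : B → A) xs → tally f (map g xs) ≡ tally (f ∘ g) xs
  tally-map g []       = refl
  tally-map g (x ∷ xs) with f (g x)
  ... | true  = cong suc (tally-map g xs)
  ... | false = tally-map g xs

  tally-↭ : ∀ {xs ys} → xs ↭ ys → tally f xs ≡ tally f ys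
  tally-↭ p = ↭-length (filter-↭ (T? ∘ f) p)

tally-cong : ∀ {A : Set} {f g : A → Bool} {xs} → All (λ x → f x ≡ g x) xs → tally f xs ≡ tally g xs
tally-cong                 []       = refl
tally-cong {f = f} {g} {x ∷ _} (e ∷ es) with f x | g x | e
... | true  | .true  | refl = cong suc (tally-cong es)
... | false | .false | refl = tally-cong es

module _ {A : Set} {P : A → Set} (P? : Decidable P) where

  filter-partition-↭ : ∀ xs → filter P? xs ++ filter (∁? P?) xs ↭ xs
  filter-partition-↭ []       = _↭_.refl
  filter-partition-↭ (x ∷ xs) with P? x
  ... | yes _ = prep x (filter-partition-↭ xs)
  ... | no _  = ↭-trans (shift x (filter P? xs) _) (prep x (filter-partition-↭ xs))

module _ {A B : Set} where

  map-proj₁-zip : ∀ (xs : List A) (ys : List B) → length xs ≤ length ys → map proj₁ (zip xs ys) ≡ xs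
  map-proj₁-zip []       ys       _         = refl
  map-proj₁-zip (x ∷ xs) (y ∷ ys) (s≤s le) = cong (x ∷_) (map-proj₁-zip xs ys le)

  map-proj₂-zip : ∀ (xs : List A) (ys : List B) → length ys ≤ length xs → map proj₂ (zip xs ys) ≡ ys
  map-proj₂-zip []       []       _         = refl
  map-proj₂-zip (x ∷ xs) []       _         = refl
  map-proj₂-zip (x ∷ xs) (y ∷ ys) (s≤s le) = cong (y ∷_) (map-proj₂-zip xs ys le)

module _ {A B : Set} {P : A → Set} (P? : Decidable P) {Q : B → Set} where

  private
    Matched : A × B → Set
    Matched (x , y) = P x → Q y

    zip-rejected : ∀ {xs} → All (λ x → ¬ P x) xs → ∀ ys → All Matched (zip xs ys)
    zip-rejected []         _        = []
    zip-rejected (¬px ∷ ¬p) []       = []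
    zip-rejected (¬px ∷ ¬p) (y ∷ ys) = (λ px → ⊥-elim (¬px px)) ∷ zip-rejected ¬p ys

    zip-prefix : ∀ us {ws} vs zs → length us ≤ length vs → All (λ x → ¬ P x) ws → All Q vs →
                 All Matched (zip (us ++ ws) (vs ++ zs))
    zip-prefix []       vs       zs _         ¬p _          = zip-rejected ¬p (vs ++ zs)
    zip-prefix (u ∷ us) (v ∷ vs) zs (s≤s le) ¬p (qv ∷ qvs) = (λ _ → qv) ∷ zip-prefix us vs zs le ¬p qvs

  -- The elements satisfying P come first in sorted, so zip matches them with ys.
  pair-off : ∀ xs ys zs → length (filter P? xs) ≤ length ys → length xs ≡ length ys + length zs → All Q ys →
             Σ[ Z ∈ List (A × B) ] (map proj₁ Z ↭ xs × map proj₂ Z ≡ ys ++ zs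
                                    × All (λ (x , y) → P x → Q y) Z)
  pair-off xs ys zs matchable lengths qys =
    zip sorted (ys ++ zs) , ↭-trans (↭-reflexive (map-proj₁-zip _ _ (≤-reflexive same-length))) sorted↭xs
    , map-proj₂-zip _ _ (≤-reflexive (sym same-length)) , zip-prefix _ ys zs matchable (all-filter (∁? P?) xs) qys
    where
    sorted : List A
    sorted = filter P? xs ++ filter (∁? P?) xs
    sorted↭xs : sorted ↭ xs
    sorted↭xs = filter-partition-↭ P? xs
    same-length : length sorted ≡ length (ys ++ zs)
    same-length = trans (↭-length sorted↭xs) (trans lengths (sym (length-++ ys)))

T-∨³ : ∀ {x y z} → T (x ∨ y ∨ z) → T x ⊎ T y ⊎ T z
T-∨³ = map₂ (to T-∨) ∘ to T-∨

T-∨⁴ : ∀ {w x y z} → T (w ∨ x ∨ y ∨ z) → T w ⊎ T x ⊎ T y ⊎ T z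
T-∨⁴ = map₂ T-∨³ ∘ to T-∨

module _ {A : Set} {P : A → Set} where

  All-toList : ∀ {k} (v : Vec A k) → (∀ j → P (lookup v j)) → All P (toList v)
  All-toList Vec.[]       _  = []
  All-toList (x Vec.∷ v) pv = pv Fin.zero ∷ All-toList v (pv ∘ Fin.suc)

  lookup-fromList : ∀ {xs} → All P xs → ∀ j → P (lookup (fromList xs) j)
  lookup-fromList (px ∷ _)   Fin.zero    = px
  lookup-fromList (_  ∷ pxs) (Fin.suc j) = lookup-fromList pxs j

module _ {n : ℕ} where

  occurrences : List (Subset n) → Fin n → ℕ
  occurrences Ds x = tally (λ D → lookup D x) Ds

  count-fromList : ∀ Ds x → count (fromList Ds) x ≡ occurrences Ds x
  count-fromList []       x = refl
  count-fromList (D ∷ Ds) x with lookup D x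
  ... | true  = cong suc (count-fromList Ds x)
  ... | false = count-fromList Ds x

  count-toList : ∀ {m} (Ds : Vec (Subset n) m) x → count Ds x ≡ occurrences (toList Ds) x
  count-toList Vec.[]       x = refl
  count-toList (D Vec.∷ Ds) x with lookup D x
  ... | true  = cong suc (count-toList Ds x)
  ... | false = count-toList Ds x

  ∈⇒T : ∀ {x} {D : Subset n} → x ∈ D → T (lookup D x)
  ∈⇒T x∈D rewrite []=⇒lookup x∈D = _

  T⇒∈ : ∀ {x} {D : Subset n} → T (lookup D x) → x ∈ D
  T⇒∈ {x} {D} t with lookup D x in eq
  ... | true = lookup⇒[]= x D eq

  ListConfiguration : Graph n → ℕ → ℕ → Set
  ListConfiguration G m s = Σ[ Ds ∈ List (Subset n) ]
    (length Ds ≡ m × All (Dominating G) Ds × (∀ x → V G x → occurrences Ds x ≤ s))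

  Configuration⇔ListConfiguration : ∀ {G m s} → Configuration G m s ⇔ ListConfiguration G m s
  Configuration⇔ListConfiguration {s = s} = mk⇔
    (λ (Ds , dom , load) → toList Ds , length-toList Ds , All-toList Ds dom
                         , λ x vx → subst (_≤ s) (count-toList Ds x) (load x vx))
    (λ { (Ds , refl , dom , load) → fromList Ds , lookup-fromList dom
                                  , λ x vx → subst (_≤ s) (sym (count-fromList Ds x)) (load x vx) })

  DominatedBy : Graph n → Subset n → Fin n → Set
  DominatedBy G X x = x ∈ X ⊎ ∃[ y ] (y ∈ X × E G x y)

  ∪-dominating : ∀ {G H D X} → (∀ {x} → V H x → V G x) → (∀ {x y} → E H x y → E G x y) →
                 Dominating H D → (∀ x → x ∈ X → V G x) → (∀ x → V G x → V H x ⊎ DominatedBy G X x) →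
                 Dominating G (D ∪ X)
  ∪-dominating {G} {H} {D} {X} V⊆ E⊆ (D⊆H , D-dom) X⊆G X-dom = ⊆G , dom
    where
    ⊆G : ∀ x → x ∈ D ∪ X → V G x
    ⊆G x x∈ = [ V⊆ ∘ D⊆H x , X⊆G x ]′ (x∈p∪q⁻ D X x∈)
    dom : ∀ x → V G x → ¬ x ∈ D ∪ X → ∃[ y ] (y ∈ D ∪ X × E G x y)
    dom x vx x∉ with X-dom x vx
    ... | inj₁ vh with D-dom x vh (x∉ ∘ p⊆p∪q X)
    ...   | y , y∈D , e = y , p⊆p∪q X y∈D , E⊆ e
    dom x vx x∉ | inj₂ (inj₁ x∈X)           = ⊥-elim (x∉ (q⊆p∪q D X x∈X))
    dom x vx x∉ | inj₂ (inj₂ (y , y∈X , e)) = y , q⊆p∪q D X y∈X , e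

  module _ {A : Set} (X : A → Subset n) where

    join : Subset n × A → Subset n
    join (D , α) = D ∪ X α

    private
      lookup-join : ∀ x z → lookup (join z) x ≡ lookup (proj₁ z) x ∨ lookup (X (proj₂ z)) x
      lookup-join x (D , α) = lookup-zipWith _∨_ x D (X α)

    occurrences-join-outside : ∀ x Z → (∀ α → lookup (X α) x ≡ false) →
                               occurrences (map join Z) x ≡ occurrences (map proj₁ Z) x
    occurrences-join-outside x Z x∉X = begin
      occurrences (map join Z) x                ≡⟨ tally-map _ join Z ⟩
      tally (λ z → lookup (join z) x) Z         ≡⟨ tally-cong (All.universal same Z) ⟩
      tally (λ z → lookup (proj₁ z) x) Z        ≡⟨ tally-map _ proj₁ Z ⟨
      occurrences (map proj₁ Z) x               ∎
      where
      open ≡-Reasoning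
      same : ∀ z → lookup (join z) x ≡ lookup (proj₁ z) x
      same z@(D , α) rewrite lookup-join x z | x∉X α = ∨-identityʳ (lookup D x)

    occurrences-join-inside : ∀ x Z → All (λ (D , α) → T (lookup D x) → T (lookup (X α) x)) Z →
                              occurrences (map join Z) x ≡ tally (λ α → lookup (X α) x) (map proj₂ Z)
    occurrences-join-inside x Z D⊆X = begin
      occurrences (map join Z) x                ≡⟨ tally-map _ join Z ⟩
      tally (λ z → lookup (join z) x) Z         ≡⟨ tally-cong (All.map (λ {z} → same {z}) D⊆X) ⟩
      tally (λ z → lookup (X (proj₂ z)) x) Z    ≡⟨ tally-map _ proj₂ Z ⟨
      tally (λ α → lookup (X α) x) (map proj₂ Z) ∎
      where
      open ≡-Reasoning
      same : ∀ {z} → (T (lookup (proj₁ z) x) → T (lookup (X (proj₂ z)) x)) →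
             lookup (join z) x ≡ lookup (X (proj₂ z)) x
      same {z@(D , α)} ⊆ rewrite lookup-join x z with lookup D x | lookup (X α) x
      ... | false | _    = refl
      ... | true  | true = refl
      ... | true  | false = ⊥-elim (⊆ _)

data Slot : Set where
  a₀ a₁ a₂ aᵣ b₀ b₁ b₂ b₃ bᵣ : Slot

slot-index : Slot → ℕ
slot-index a₀ = 0
slot-index a₁ = 1
slot-index a₂ = 2
slot-index aᵣ = 3
slot-index b₀ = 4
slot-index b₁ = 5
slot-index b₂ = 6
slot-index b₃ = 7
slot-index bᵣ = 8

_=ˢ_ : Slot → Slot → Bool
α =ˢ β = slot-index α ℕ.≡ᵇ slot-index β

-- For k = 3 + m the 2k + 1 dominating sets are indexed by slotList m: k slots of kind a, k + 1 of kind b.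
aSlots bSlots slotList : ℕ → List Slot
aSlots m = a₀ ∷ a₁ ∷ a₂ ∷ replicate m aᵣ
bSlots m = b₀ ∷ b₁ ∷ b₂ ∷ b₃ ∷ replicate m bᵣ
slotList m = aSlots m ++ bSlots m

length-slotList : ∀ m → length (slotList m) ≡ 2 * (3 + m) + 1
length-slotList m = begin
  length (aSlots m ++ bSlots m)                               ≡⟨ length-++ (aSlots m) ⟩
  3 + length (replicate m aᵣ) + (4 + length (replicate m bᵣ)) ≡⟨ cong₂ (λ i j → 3 + i + (4 + j))
                                                                        (length-replicate m) (length-replicate m) ⟩
  3 + m + (4 + m)                                             ≡⟨ arith m ⟩
  2 * (3 + m) + 1                                             ∎
  where
  open ≡-Reasoning
  arith : ∀ i → 3 + i + (4 + i) ≡ 2 * (3 + i) + 1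
  arith = solve-∀

data Phase : Set where
  φ₀ φ₁ φ₂ : Phase

next : Phase → Phase
next φ₀ = φ₁
next φ₁ = φ₂
next φ₂ = φ₀

-- Vertex i of a path p 0, …, p m has phase (m − i) mod 3.
phase : ∀ {m} → Fin (suc m) → Phase
phase {m}     Fin.zero    = fold φ₀ next m
phase {suc m} (Fin.suc i) = phase i

phase-last : ∀ m → phase (fromℕ m) ≡ φ₀
phase-last zero    = refl
phase-last (suc m) = phase-last m

phase-step : ∀ {m} (j : Fin m) → phase (inject₁ j) ≡ next (phase (Fin.suc j))
phase-step Fin.zero    = refl
phase-step (Fin.suc j) = phase-step j

data Role : Set where
  path left opposite right : Phase → Role

-- A vertex of role ρ joins the sets whose slot is listed in table ρ (all copies of a listed aᵣ or bᵣ).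
-- On the 4-cycle a b c d attached at a, the roles of b, c, d are left, opposite, right, with the phase of a.
table : Role → List Slot
table (path φ₀)     = a₀ ∷ a₁ ∷ a₂ ∷ aᵣ ∷ []
table (path φ₁)     = b₀ ∷ b₁ ∷ []
table (path φ₂)     = a₀ ∷ b₂ ∷ b₃ ∷ bᵣ ∷ []
table (left φ₀)     = a₀ ∷ a₁ ∷ b₀ ∷ []
table (left φ₁)     = b₀ ∷ b₂ ∷ b₃ ∷ bᵣ ∷ []
table (left φ₂)     = a₀ ∷ a₁ ∷ a₂ ∷ aᵣ ∷ []
table (opposite φ₀) = b₁ ∷ b₂ ∷ b₃ ∷ bᵣ ∷ []
table (opposite φ₁) = a₀ ∷ a₁ ∷ a₂ ∷ aᵣ ∷ []
table (opposite φ₂) = a₁ ∷ b₀ ∷ b₁ ∷ aᵣ ∷ []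
table (right φ₀)    = a₂ ∷ b₀ ∷ b₁ ∷ aᵣ ∷ []
table (right φ₁)    = b₁ ∷ b₂ ∷ b₃ ∷ bᵣ ∷ []
table (right φ₂)    = a₂ ∷ b₂ ∷ b₃ ∷ bᵣ ∷ []

slots : Role → Slot → Bool
slots ρ α = any (α =ˢ_) (table ρ)

∀-slot : {P : Slot → Set} → P a₀ × P a₁ × P a₂ × P aᵣ × P b₀ × P b₁ × P b₂ × P b₃ × P bᵣ →
         ∀ α → P α
∀-slot (p , _) a₀                             = p
∀-slot (_ , p , _) a₁                         = p
∀-slot (_ , _ , p , _) a₂                     = p
∀-slot (_ , _ , _ , p , _) aᵣ                 = p
∀-slot (_ , _ , _ , _ , p , _) b₀             = p
∀-slot (_ , _ , _ , _ , _ , p , _) b₁         = p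
∀-slot (_ , _ , _ , _ , _ , _ , p , _) b₂     = p
∀-slot (_ , _ , _ , _ , _ , _ , _ , p , _) b₃ = p
∀-slot (_ , _ , _ , _ , _ , _ , _ , _ , p) bᵣ = p

∀-phase : {P : Phase → Set} → P φ₀ × P φ₁ × P φ₂ → ∀ φ → P φ
∀-phase (p , _) φ₀     = p
∀-phase (_ , p , _) φ₁ = p
∀-phase (_ , _ , p) φ₂ = p

∀-role : {P : Role → Set} →
         (∀ φ → P (path φ)) × (∀ φ → P (left φ)) × (∀ φ → P (opposite φ)) × (∀ φ → P (right φ)) →
         ∀ ρ → P ρ
∀-role (p , _)         (path φ)     = p φ
∀-role (_ , p , _)     (left φ)     = p φ
∀-role (_ , _ , p , _) (opposite φ) = p φ
∀-role (_ , _ , _ , p) (right φ)    = p φ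

Balanced : (Slot → Bool) → Bool
Balanced S = (tally S (slotList 0) ≤ᵇ 3) ∧ not (S aᵣ ∧ S bᵣ)

-- Here and below the underscores are tuples of T true, found by evaluating the tables.
balanced : ∀ ρ → T (Balanced (slots ρ))
balanced = ∀-role {λ ρ → T (Balanced (slots ρ))} (∀-phase _ , ∀-phase _ , ∀-phase _ , ∀-phase _)

tally-unrepeated : ∀ S m → T (not (S aᵣ ∧ S bᵣ)) → tally S (replicate m aᵣ) + tally S (replicate m bᵣ) ≤ m
tally-unrepeated S m u rewrite tally-replicate S m aᵣ | tally-replicate S m bᵣ with S aᵣ | S bᵣ
... | true  | true  = ⊥-elim u
... | true  | false = ≤-reflexive (+-identityʳ m)
... | false | true  = ≤-refl
... | false | false = z≤n

tally-balanced : ∀ S m → T (Balanced S) → tally S (slotList m) ≤ 3 + m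
tally-balanced S m b = begin
  tally S (slotList m)                                              ≡⟨ split ⟩
  tally S fixedA + (tally S repA + (tally S fixedB + tally S repB)) ≡⟨ interchange (tally S fixedA) (tally S repA)
                                                                                   (tally S fixedB) (tally S repB) ⟩
  (tally S fixedA + tally S fixedB) + (tally S repA + tally S repB) ≤⟨ +-mono-≤ fixed repeated ⟩
  3 + m                                                             ∎
  where
  open ≤-Reasoning
  fixedA fixedB repA repB : List Slot
  fixedA = a₀ ∷ a₁ ∷ a₂ ∷ []
  fixedB = b₀ ∷ b₁ ∷ b₂ ∷ b₃ ∷ []
  repA   = replicate m aᵣ
  repB   = replicate m bᵣ
  split : tally S (slotList m) ≡ tally S fixedA + (tally S repA + (tally S fixedB + tally S repB))
  split = trans (tally-++ S fixedA (repA ++ bSlots m))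
                (cong (tally S fixedA +_) (trans (tally-++ S repA (bSlots m)) (cong (tally S repA +_) (tally-++ S fixedB repB))))
  interchange : ∀ a b c d → a + (b + (c + d)) ≡ (a + c) + (b + d)
  interchange = solve-∀
  fixed : tally S fixedA + tally S fixedB ≤ 3
  fixed = subst (_≤ 3) (tally-++ S fixedA fixedB) (≤ᵇ⇒≤ _ 3 (proj₁ (to T-∧ b)))
  repeated : tally S repA + tally S repB ≤ m
  repeated = tally-unrepeated S m (proj₂ (to T-∧ b))

load : ∀ ρ m → tally (slots ρ) (slotList m) ≤ 3 + m
load ρ m = tally-balanced (slots ρ) m (balanced ρ)

cover-path : ∀ φ α → T (slots (path φ) α ∨ slots (path (next φ)) α ∨ slots (path (next (next φ))) α)
cover-path = ∀-phase (∀-slot _ , ∀-slot _ , ∀-slot _)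

cover-attachment : ∀ {q} φ → next φ ≡ q → ∀ α → T (slots (path q) α ∨ slots (left q) α ∨ slots (right q) α
                                                      ∨ slots (path φ) α)
cover-attachment φ₀ refl = ∀-slot _
cover-attachment φ₁ refl = ∀-slot _
cover-attachment φ₂ refl = ∀-slot _

cover-left : ∀ q α → T (slots (path q) α ∨ slots (left q) α ∨ slots (opposite q) α)
cover-left = ∀-phase (∀-slot _ , ∀-slot _ , ∀-slot _)

cover-opposite : ∀ q α → T (slots (left q) α ∨ slots (opposite q) α ∨ slots (right q) α)
cover-opposite = ∀-phase (∀-slot _ , ∀-slot _ , ∀-slot _)

cover-right : ∀ q α → T (slots (path q) α ∨ slots (right q) α ∨ slots (opposite q) α)
cover-right = ∀-phase (∀-slot _ , ∀-slot _ , ∀-slot _)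

aSlots-in-path-φ₀ : ∀ m → All (T ∘ slots (path φ₀)) (aSlots m)
aSlots-in-path-φ₀ m = _ ∷ _ ∷ _ ∷ replicate⁺ m _

record Cycle4 {n} (C : Graph n) (a b c d : Fin n) : Set where
  field
    a≢b : a ≢ b
    a≢c : a ≢ c
    a≢d : a ≢ d
    b≢c : b ≢ c
    b≢d : b ≢ d
    c≢d : c ≢ d
    ab : E C a b
    bc : E C b c
    cd : E C c d
    da : E C d a
    vertices : ∀ {x} → V C x → x ≡ a ⊎ x ≡ b ⊎ x ≡ c ⊎ x ≡ d

module _ {n} {C : Graph n} where

  IsC4⇒Cycle4 : IsC4 C → Σ[ a ∈ Fin n ] Σ[ b ∈ Fin n ] Σ[ c ∈ Fin n ] Σ[ d ∈ Fin n ] Cycle4 C a b c d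
  IsC4⇒Cycle4 (a , b , c , d , a≢b , a≢c , a≢d , b≢c , b≢d , c≢d , V-C , E-C) = a , b , c , d , record
    { a≢b = a≢b ; a≢c = a≢c ; a≢d = a≢d ; b≢c = b≢c ; b≢d = b≢d ; c≢d = c≢d
    ; ab = from (E-C a b) (inj₁ (inj₁ (refl , refl)))
    ; bc = from (E-C b c) (inj₂ (inj₁ (inj₁ (refl , refl))))
    ; cd = from (E-C c d) (inj₂ (inj₂ (inj₁ (inj₁ (refl , refl)))))
    ; da = from (E-C d a) (inj₂ (inj₂ (inj₂ (inj₁ (refl , refl)))))
    ; vertices = to (V-C _)
    }

  rotate : ∀ {a b c d} → Cycle4 C a b c d → Cycle4 C b c d a
  rotate cyc = record
    { a≢b = b≢c ; a≢c = b≢d ; a≢d = a≢b ∘ sym ; b≢c = c≢d ; b≢d = a≢c ∘ sym ; c≢d = a≢d ∘ sym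
    ; ab = bc ; bc = cd ; cd = da ; da = ab
    ; vertices = [ inj₂ ∘ inj₂ ∘ inj₂ , [ inj₁ , [ inj₂ ∘ inj₁ , inj₂ ∘ inj₂ ∘ inj₁ ]′ ]′ ]′ ∘ vertices
    }
    where open Cycle4 cyc

  Cycle4-from : ∀ {a b c d v} → Cycle4 C a b c d → V C v →
                Σ[ b′ ∈ Fin n ] Σ[ c′ ∈ Fin n ] Σ[ d′ ∈ Fin n ] Cycle4 C v b′ c′ d′
  Cycle4-from cyc vv with Cycle4.vertices cyc vv
  ... | inj₁ refl                 = _ , _ , _ , cyc
  ... | inj₂ (inj₁ refl)          = _ , _ , _ , rotate cyc
  ... | inj₂ (inj₂ (inj₁ refl))   = _ , _ , _ , rotate (rotate cyc)
  ... | inj₂ (inj₂ (inj₂ refl))   = _ , _ , _ , rotate (rotate (rotate cyc))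

-- The construction never needs the path to be binary.
record Dumbbell {n} (G H₁ H₂ : Graph n) : Set where
  field
    H₁∩H₂    : ∀ x y → V H₁ x → V H₂ x → V H₁ y → V H₂ y → x ≡ y
    l        : ℕ
    p        : Fin (suc l) → Fin n
    p-inj    : ∀ i j → p i ≡ p j → i ≡ j
    p-edge   : ∀ (i : Fin l) → E G (p (inject₁ i)) (p (Fin.suc i))
    p∈H₁     : ∀ i → V H₁ (p i) ⇔ (i ≡ Fin.zero)
    p∈H₂     : ∀ i → V H₂ (p i) ⇔ (i ≡ fromℕ l)
    disjoint : 1 ≤ l → ∀ x → V H₁ x → V H₂ x → ⊥
    V-G      : ∀ x → V G x ⇔ (V H₁ x ⊎ V H₂ x ⊎ ∃[ i ] x ≡ p i)
    H₁⊆G     : ∀ {x y} → E H₁ x y → E G x y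
    H₂⊆G     : ∀ {x y} → E H₂ x y → E G x y

IsDumbbell⇒Dumbbell : ∀ {n} {G H₁ H₂ : Graph n} → IsDumbbell G H₁ H₂ → Dumbbell G H₁ H₂
IsDumbbell⇒Dumbbell (H₁∩H₂ , l , p , p-inj , p-edge , _ , p∈H₁ , p∈H₂ , disjoint , V-G , E-G) = record
  { H₁∩H₂ = H₁∩H₂ ; l = l ; p = p ; p-inj = p-inj ; p-edge = p-edge ; p∈H₁ = p∈H₁ ; p∈H₂ = p∈H₂
  ; disjoint = disjoint ; V-G = V-G
  ; H₁⊆G = λ e → from (E-G _ _) (inj₁ e)
  ; H₂⊆G = λ e → from (E-G _ _) (inj₂ (inj₁ e))
  }

module Gadget {n} {G C H : Graph n} (db : Dumbbell G C H) {a b c d : Fin n} (cyc : Cycle4 C a b c d)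
              (p₀≡a : Dumbbell.p db Fin.zero ≡ a) where

  open Dumbbell db
  open Cycle4 cyc

  pₗ : Fin n
  pₗ = p (fromℕ l)

  q : Phase
  q = phase (Fin.zero {l})

  cycle-role : Fin n → Maybe Role
  cycle-role x with x Fin.≟ b | x Fin.≟ c | x Fin.≟ d
  ... | yes _ | _     | _     = just (left q)
  ... | no _  | yes _ | _     = just (opposite q)
  ... | no _  | no _  | yes _ = just (right q)
  ... | no _  | no _  | no _  = nothing

  role : Fin n → Maybe Role
  role x with any? (λ i → p i Fin.≟ x)
  ... | yes (i , _) = just (path (phase i))
  ... | no _        = cycle-role x

  joins : Slot → Fin n → Bool
  joins α x = maybe′ (λ ρ → slots ρ α) false (role x)

  gadget : Slot → Subset n
  gadget α = tabulate (joins α)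

  lookup-gadget : ∀ {x ρ} α → role x ≡ just ρ → lookup (gadget α) x ≡ slots ρ α
  lookup-gadget {x} α eq = trans (lookup∘tabulate (joins α) x) (cong (maybe′ (λ ρ → slots ρ α) false) eq)

  lookup-gadget-nothing : ∀ {x} α → role x ≡ nothing → lookup (gadget α) x ≡ false
  lookup-gadget-nothing {x} α eq = trans (lookup∘tabulate (joins α) x) (cong (maybe′ (λ ρ → slots ρ α) false) eq)

  ∈-gadget : ∀ {y ρ} α → role y ≡ just ρ → T (slots ρ α) → y ∈ gadget α
  ∈-gadget α eq t = T⇒∈ (subst T (sym (lookup-gadget α eq)) t)

  V-C⊆G : ∀ {x} → V C x → V G x
  V-C⊆G vx = from (V-G _) (inj₁ vx)

  V-H⊆G : ∀ {x} → V H x → V G x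
  V-H⊆G vx = from (V-G _) (inj₂ (inj₁ vx))

  V-p⊆G : ∀ i → V G (p i)
  V-p⊆G i = from (V-G _) (inj₂ (inj₂ (i , refl)))

  b∈C : V C b
  b∈C = E-V C bc
  c∈C : V C c
  c∈C = E-V C cd
  d∈C : V C d
  d∈C = E-V C da

  off-path : ∀ {y} → V C y → y ≢ a → ∀ i → p i ≢ y
  off-path vy y≢a i refl = y≢a (trans (cong p (to (p∈H₁ i) vy)) p₀≡a)

  outside-H : ∀ {y} → V C y → y ≢ a → ¬ V H y
  outside-H {y} vy y≢a vh with l ℕ.≟ 0
  ... | no l≢0  = disjoint (n≢0⇒n>0 l≢0) y vy vh
  ... | yes l≡0 = y≢a (trans (H₁∩H₂ y (p Fin.zero) vy vh (from (p∈H₁ Fin.zero) refl) p₀∈H) p₀≡a)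
    where
    p₀∈H : V H (p Fin.zero)
    p₀∈H = from (p∈H₂ Fin.zero) (toℕ-injective (sym (trans (toℕ-fromℕ l) l≡0)))

  role-p : ∀ i → role (p i) ≡ just (path (phase i))
  role-p i with any? (λ j → p j Fin.≟ p i)
  ... | yes (j , e) rewrite p-inj j i e = refl
  ... | no ∄       = ⊥-elim (∄ (i , refl))

  role-p′ : ∀ {i φ} → phase i ≡ φ → role (p i) ≡ just (path φ)
  role-p′ refl = role-p _

  role-a : role a ≡ just (path q)
  role-a = subst (λ y → role y ≡ just (path q)) p₀≡a (role-p Fin.zero)

  role-cycle : ∀ {y} → V C y → y ≢ a → role y ≡ cycle-role y
  role-cycle {y} vy y≢a with any? (λ i → p i Fin.≟ y)
  ... | yes (i , e) = ⊥-elim (off-path vy y≢a i e)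
  ... | no _        = refl

  role-b : role b ≡ just (left q)
  role-b rewrite role-cycle b∈C (a≢b ∘ sym) with b Fin.≟ b
  ... | yes _   = refl
  ... | no b≢b = ⊥-elim (b≢b refl)

  role-c : role c ≡ just (opposite q)
  role-c rewrite role-cycle c∈C (a≢c ∘ sym) with c Fin.≟ b | c Fin.≟ c
  ... | yes c≡b | _       = ⊥-elim (b≢c (sym c≡b))
  ... | no _    | yes _   = refl
  ... | no _    | no c≢c = ⊥-elim (c≢c refl)

  role-d : role d ≡ just (right q)
  role-d rewrite role-cycle d∈C (a≢d ∘ sym) with d Fin.≟ b | d Fin.≟ c | d Fin.≟ d
  ... | yes d≡b | _       | _       = ⊥-elim (b≢d (sym d≡b))
  ... | no _    | yes d≡c | _       = ⊥-elim (c≢d (sym d≡c))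
  ... | no _    | no _    | yes _   = refl
  ... | no _    | no _    | no d≢d = ⊥-elim (d≢d refl)

  role-just : ∀ {x ρ} → role x ≡ just ρ → (∃[ i ] x ≡ p i) ⊎ (V C x × x ≢ a)
  role-just {x} eq with any? (λ i → p i Fin.≟ x)
  ... | yes (i , p≡x) = inj₁ (i , sym p≡x)
  ... | no _ with x Fin.≟ b | x Fin.≟ c | x Fin.≟ d
  ...   | yes refl | _        | _        = inj₂ (b∈C , a≢b ∘ sym)
  ...   | no _     | yes refl | _        = inj₂ (c∈C , a≢c ∘ sym)
  ...   | no _     | no _     | yes refl = inj₂ (d∈C , a≢d ∘ sym)
  role-just () | no _ | no _ | no _ | no _

  role-H : ∀ {x ρ} → role x ≡ just ρ → V H x → x ≡ pₗ
  role-H eq vh with role-just eq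
  ... | inj₁ (i , refl)   = cong p (to (p∈H₂ i) vh)
  ... | inj₂ (vc , x≢a)   = ⊥-elim (outside-H vc x≢a vh)

  nothing≢just : ∀ {ρ : Role} → nothing ≢ just ρ
  nothing≢just ()

  role-total : ∀ {x} → V G x → role x ≡ nothing → V H x
  role-total {x} vx eq with to (V-G x) vx
  ... | inj₂ (inj₁ vh)          = vh
  ... | inj₂ (inj₂ (i , refl))  = ⊥-elim (nothing≢just (trans (sym eq) (role-p i)))
  ... | inj₁ vc with vertices vc
  ...   | inj₁ refl               = ⊥-elim (nothing≢just (trans (sym eq) role-a))
  ...   | inj₂ (inj₁ refl)        = ⊥-elim (nothing≢just (trans (sym eq) role-b))
  ...   | inj₂ (inj₂ (inj₁ refl)) = ⊥-elim (nothing≢just (trans (sym eq) role-c))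
  ...   | inj₂ (inj₂ (inj₂ refl)) = ⊥-elim (nothing≢just (trans (sym eq) role-d))

  gadget⊆G : ∀ α x → x ∈ gadget α → V G x
  gadget⊆G α x x∈ with role x in eq
  ... | just ρ with role-just eq
  ...   | inj₁ (i , refl) = V-p⊆G i
  ...   | inj₂ (vc , _)   = V-C⊆G vc
  gadget⊆G α x x∈ | nothing = ⊥-elim (subst T (lookup-gadget-nothing α eq) (∈⇒T x∈))

  via : ∀ {x y ρ} α → y ≡ x ⊎ E G x y → role y ≡ just ρ → T (slots ρ α) → DominatedBy G (gadget α) x
  via α (inj₁ refl) r t = inj₁ (∈-gadget α r t)
  via α (inj₂ e)    r t = inj₂ (_ , ∈-gadget α r t , e)

  self : ∀ {x} → x ≡ x ⊎ E G x x
  self = inj₁ refl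

  edge : ∀ {x y} → E G x y → y ≡ x ⊎ E G x y
  edge = inj₂

  dominated-left : ∀ α → DominatedBy G (gadget α) b
  dominated-left α =
    [ via α (edge (H₁⊆G (E-sym C ab))) role-a , [ via α self role-b , via α (edge (H₁⊆G bc)) role-c ]′ ]′
    (T-∨³ (cover-left q α))

  dominated-opposite : ∀ α → DominatedBy G (gadget α) c
  dominated-opposite α =
    [ via α (edge (H₁⊆G (E-sym C bc))) role-b , [ via α self role-c , via α (edge (H₁⊆G cd)) role-d ]′ ]′
    (T-∨³ (cover-opposite q α))

  dominated-right : ∀ α → DominatedBy G (gadget α) d
  dominated-right α =
    [ via α (edge (H₁⊆G da)) role-a , [ via α self role-d , via α (edge (H₁⊆G (E-sym C cd))) role-c ]′ ]′
    (T-∨³ (cover-right q α))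

  dominated-path : ∀ α i (j : Fin l) → i ≡ inject₁ j → DominatedBy G (gadget α) (p i)
  dominated-path α Fin.zero j i≡j =
    [ via α self (role-p Fin.zero)
    , [ via α (edge (subst (λ y → E G y b) (sym p₀≡a) (H₁⊆G ab))) role-b
      , [ via α (edge (subst (λ y → E G y d) (sym p₀≡a) (H₁⊆G (E-sym C da)))) role-d
        , via α (edge (subst (λ i → E G (p i) (p (Fin.suc j))) (sym i≡j) (p-edge j))) (role-p (Fin.suc j)) ]′ ]′ ]′
    (T-∨⁴ (cover-attachment (phase (Fin.suc j)) (sym (trans (cong phase i≡j) (phase-step j))) α))
  dominated-path α (Fin.suc i) j i≡j =
    [ via α (edge (subst (λ i → E G (p i) (p (Fin.suc j))) (sym i≡j) (p-edge j))) (role-p (Fin.suc j))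
    , [ via α self (role-p′ step₁)
      , via α (edge (E-sym G (p-edge i))) (role-p′ (trans (phase-step i) (cong next step₁))) ]′ ]′
    (T-∨³ (cover-path (phase (Fin.suc j)) α))
    where
    step₁ : phase (Fin.suc i) ≡ next (phase (Fin.suc j))
    step₁ = trans (cong phase i≡j) (phase-step j)

  on-path : ∀ α i → V H (p i) ⊎ DominatedBy G (gadget α) (p i)
  on-path α i with l ℕ.≟ toℕ i
  ... | yes l≡i = inj₁ (from (p∈H₂ i) (toℕ-injective (trans (sym l≡i) (sym (toℕ-fromℕ l)))))
  ... | no l≢i  = inj₂ (dominated-path α i (lower₁ i l≢i) (sym (inject₁-lower₁ i l≢i)))

  dominated-outside-H : ∀ α x → V G x → V H x ⊎ DominatedBy G (gadget α) x
  dominated-outside-H α x vx with to (V-G x) vx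
  ... | inj₂ (inj₁ vh)         = inj₁ vh
  ... | inj₂ (inj₂ (i , refl)) = on-path α i
  ... | inj₁ vc with vertices vc
  ...   | inj₁ refl               = subst (λ y → V H y ⊎ DominatedBy G (gadget α) y) p₀≡a (on-path α Fin.zero)
  ...   | inj₂ (inj₁ refl)        = inj₂ (dominated-left α)
  ...   | inj₂ (inj₂ (inj₁ refl)) = inj₂ (dominated-opposite α)
  ...   | inj₂ (inj₂ (inj₂ refl)) = inj₂ (dominated-right α)

  role-pₗ : role pₗ ≡ just (path φ₀)
  role-pₗ = role-p′ (phase-last l)

  module Extension (m : ℕ) (L : List (Subset n)) (|L| : length L ≡ 2 * (3 + m) + 1)
                   (L-dom : All (Dominating H) L) (L-load : ∀ x → V H x → occurrences L x ≤ 3 + m) where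

    -- The sets containing pₗ get slots of kind a, which is possible as there are at most 3 + m of them.
    pairing : Σ[ Z ∈ List (Subset n × Slot) ] (map proj₁ Z ↭ L × map proj₂ Z ≡ slotList m
                × All (λ (D , α) → T (lookup D pₗ) → T (slots (path φ₀) α)) Z)
    pairing = pair-off (T? ∘ (λ D → lookup D pₗ)) L (aSlots m) (bSlots m) pₗ-load
                       (trans |L| (trans (sym (length-slotList m)) (length-++ (aSlots m))))
                       (aSlots-in-path-φ₀ m)
      where
      pₗ-load : occurrences L pₗ ≤ length (aSlots m)
      pₗ-load = subst (occurrences L pₗ ≤_) (sym (cong (3 +_) (length-replicate m)))
                      (L-load pₗ (from (p∈H₂ (fromℕ l)) refl))

    Z : List (Subset n × Slot)
    Z = proj₁ pairing

    Z↭L : map proj₁ Z ↭ L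
    Z↭L = proj₁ (proj₂ pairing)

    Z-slots : map proj₂ Z ≡ slotList m
    Z-slots = proj₁ (proj₂ (proj₂ pairing))

    Z-matched : All (λ (D , α) → T (lookup D pₗ) → T (slots (path φ₀) α)) Z
    Z-matched = proj₂ (proj₂ (proj₂ pairing))

    Z-dom : All (Dominating H ∘ proj₁) Z
    Z-dom = map⁻ (All-resp-↭ (↭-sym Z↭L) L-dom)

    family : List (Subset n)
    family = map (join gadget) Z

    length-family : length family ≡ 2 * (3 + m) + 1
    length-family = trans (length-map (join gadget) Z)
                          (trans (sym (length-map proj₁ Z)) (trans (↭-length Z↭L) |L|))

    family-dom : All (Dominating G) family
    family-dom = map⁺ (All.map (λ {(D , α)} D-dom → ∪-dominating {G = G} {H} {D} {gadget α} V-H⊆G H₂⊆G D-dom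
                                                      (gadget⊆G α) (dominated-outside-H α))
                               Z-dom)

    in-set⇒in-gadget : ∀ {x ρ} → role x ≡ just ρ → ∀ {D α} →
                       Dominating H D × (T (lookup D pₗ) → T (slots (path φ₀) α)) →
                       T (lookup D x) → T (lookup (gadget α) x)
    in-set⇒in-gadget eq {D} {α} (D-dom , matched) t with role-H eq (proj₁ D-dom _ (T⇒∈ t))
    ... | refl = subst T (sym (lookup-gadget α eq))
                   (subst (λ ρ → T (slots ρ α)) (just-injective (trans (sym role-pₗ) eq)) (matched t))

    family-load : ∀ x → V G x → occurrences family x ≤ 3 + m
    family-load x vx with role x in eq
    ... | nothing = begin
      occurrences family x          ≡⟨ occurrences-join-outside gadget x Z (λ α → lookup-gadget-nothing α eq) ⟩
      occurrences (map proj₁ Z) x   ≡⟨ tally-↭ _ Z↭L ⟩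
      occurrences L x               ≤⟨ L-load x (role-total vx eq) ⟩
      3 + m                         ∎
      where open ≤-Reasoning
    ... | just ρ = begin
      occurrences family x                              ≡⟨ occurrences-join-inside gadget x Z
                                                             (All.zipWith (λ {(D , α)} → in-set⇒in-gadget eq {D} {α})
                                                                          (Z-dom , Z-matched)) ⟩
      tally (λ α → lookup (gadget α) x) (map proj₂ Z)   ≡⟨ cong (tally (λ α → lookup (gadget α) x)) Z-slots ⟩
      tally (λ α → lookup (gadget α) x) (slotList m)    ≡⟨ tally-cong (All.universal (λ α → lookup-gadget α eq)
                                                                                     (slotList m)) ⟩
      tally (slots ρ) (slotList m)                      ≤⟨ load ρ m ⟩
      3 + m                                             ∎
      where open ≤-Reasoning

    extended : ListConfiguration G (2 * (3 + m) + 1) (3 + m)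
    extended = family , length-family , family-dom , family-load

  extend : ∀ m → ListConfiguration H (2 * (3 + m) + 1) (3 + m) → ListConfiguration G (2 * (3 + m) + 1) (3 + m)
  extend m (L , |L| , L-dom , L-load) = Extension.extended m L |L| L-dom L-load

lemma12 : ∀ {n} (G C H : Graph n) → IsC4 C → IsDumbbell G C H →
          (k : ℕ) → 3 ≤ k → Configuration H (2 * k + 1) k →
          Configuration G (2 * k + 1) k
lemma12 G C H isC4 isDumbbell (suc (suc (suc m))) (s≤s (s≤s (s≤s z≤n))) conf =
  let dumbbell               = IsDumbbell⇒Dumbbell {G = G} {C} {H} isDumbbell
      (_ , _ , _ , _ , C₄)   = IsC4⇒Cycle4 {C = C} isC4
      (_ , _ , _ , C₄-at-p₀) = Cycle4-from C₄ (from (Dumbbell.p∈H₁ dumbbell Fin.zero) refl)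
  in from (Configuration⇔ListConfiguration {G = G})
       (Gadget.extend dumbbell C₄-at-p₀ refl m (to (Configuration⇔ListConfiguration {G = H}) conf))
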